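{- For all positive integers $M,n$, $Y(M,n)\ge \sum_{i=1}^M Y_1(i,n)$.
   Context: A hypergraph $H$ on $[n]$ is a set of subsets (edges) of $[n]$; hypergraphs are assumed inclusion-free. For $w:[n]\to[M]$ and strictly increasing $f:[M]\to\mathbb{R}_{>0}$, let $fw(e)=\sum_{i\in e}f(w(i))$; $w$ is isolating for $H,f$ if exactly one edge of $H$ attains the minimum of $fw$ over $H$ (if $H$ has no edges, every $w$ is isolating). $Z(H,M,f)$ is the set of isolating $w\in[M]^n$, and $Z_1(H,M,f)$ the set of isolating $w\in[M]^n$ with $\min_x w(x)=1$. $Y(M,n)=\min_{H,f}|Z(H,M,f)|$ and $Y_1(M,n)=\min_{H,f}|Z_1(H,M,f)|$, minima over all hypergraphs $H$ on $[n]$ and all strictly increasing $f:[M]\to\mathbb{R}_{>0}$.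
   Formalization: The strictly increasing functions $f$ over which $Y(M,n)$ and $Y_1(i,n)$ are minimised take positive rational values rather than positive real values. -}

module Defs where

open import Data.Nat using (ℕ; zero; suc)
import Data.Nat as ℕ
open import Data.Fin using (Fin; zero; suc)
import Data.Fin as Fin
open import Data.Fin.Subset using (Subset; _⊆_)
open import Data.Vec using (Vec; []; _∷_)
open import Data.Bool using (Bool; true; false)
open import Data.List using (List; length; map; upTo)
open import Data.Nat.ListAction using (sum)
open import Data.List.Membership.Propositional using (_∈_)
open import Data.List.Relation.Unary.Unique.Propositional using (Unique)
open import Data.Rational using (ℚ; 0ℚ; _+_; _<_; _≤_)
open import Data.Product using (Σ; ∃; _×_; _,_)
open import Data.Sum using (_⊎_)
open import Relation.Binary.PropositionalEquality using (_≡_; _≢_)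
open import Relation.Nullary using (¬_)
open import Function.Bundles using (_⇔_)

-- Vertex set [n] is Fin n.  Value set [M] = {1,…,M} is Fin M, where the
-- element k : Fin M stands for the integer (toℕ k + 1); so "w(x) = 1" is "w x ≡ zero".

record Hypergraph (n : ℕ) : Set where
  field
    edges         : List (Subset n)
    distinct      : Unique edges
    inclusionFree : ∀ {e e′} → e ∈ edges → e′ ∈ edges → e ≢ e′ → ¬ (e ⊆ e′)
open Hypergraph public

StrictlyIncreasingPos : ∀ {M} → (Fin M → ℚ) → Set
StrictlyIncreasingPos {M} f =
  (∀ a → 0ℚ < f a) × (∀ (a b : Fin M) → a Fin.< b → f a < f b)

fw : ∀ {M n} → (Fin M → ℚ) → Vec (Fin M) n → Subset n → ℚ
fw f []       []          = 0ℚ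
fw f (x ∷ w)  (true  ∷ e) = f x + fw f w e
fw f (x ∷ w)  (false ∷ e) = fw f w e

IsMinimizer : ∀ {M n} → Hypergraph n → (Fin M → ℚ) → Vec (Fin M) n → Subset n → Set
IsMinimizer H f w e = e ∈ edges H × (∀ {e′} → e′ ∈ edges H → fw f w e ≤ fw f w e′)

Isolating : ∀ {M n} → Hypergraph n → (Fin M → ℚ) → Vec (Fin M) n → Set
Isolating H f w =
  edges H ≡ Data.List.[] ⊎
  (∃ λ e → IsMinimizer H f w e × (∀ e′ → IsMinimizer H f w e′ → e′ ≡ e))

-- min_x w(x) = 1   (all values are ≥ 1, so this says some x has w(x) = 1)
HasMinOne : ∀ {M n} → Vec (Fin (suc M)) n → Set
HasMinOne {n = n} w = ∃ λ (x : Fin n) → Data.Vec.lookup w x ≡ Fin.zero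
  where import Data.Vec

HasCard : ∀ {M n} → (Vec (Fin M) n → Set) → ℕ → Set
HasCard {M} {n} P k =
  Σ (List (Vec (Fin M) n)) λ L → Unique L × (∀ w → (w ∈ L) ⇔ P w) × length L ≡ k

CardZ : (M n : ℕ) → Hypergraph n → (Fin M → ℚ) → ℕ → Set
CardZ M n H f k = HasCard (Isolating {M} H f) k

-- |Z₁(H,M,f)| = k   (M ≥ 1, written as suc M′)
CardZ₁ : (M′ n : ℕ) → Hypergraph n → (Fin (suc M′) → ℚ) → ℕ → Set
CardZ₁ M′ n H f k = HasCard (λ w → Isolating {suc M′} H f w × HasMinOne w) k

IsY : (M n : ℕ) → ℕ → Set
IsY M n y =
  (Σ (Hypergraph n) λ H → Σ (Fin M → ℚ) λ f → StrictlyIncreasingPos f × CardZ M n H f y) ×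
  (∀ (H : Hypergraph n) (f : Fin M → ℚ) k → StrictlyIncreasingPos f → CardZ M n H f k → y ℕ.≤ k)

-- y = Y₁(M′+1, n)
IsY₁ : (M′ n : ℕ) → ℕ → Set
IsY₁ M′ n y =
  (Σ (Hypergraph n) λ H → Σ (Fin (suc M′) → ℚ) λ f → StrictlyIncreasingPos f × CardZ₁ M′ n H f y) ×
  (∀ (H : Hypergraph n) (f : Fin (suc M′) → ℚ) k → StrictlyIncreasingPos f → CardZ₁ M′ n H f k → y ℕ.≤ k)

sumFrom1 : ℕ → (ℕ → ℕ) → ℕ
sumFrom1 M g = sum (map (λ j → g (suc j)) (upTo M))

{-# OPTIONS --safe #-}
-- Every w ∈ [M+1]ⁿ either takes the value 1 or is v + 1 for a unique v ∈ [M]ⁿ, and then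
-- fw(e) = Σ_{i∈e} g(v(i)) for the strictly increasing g = f(· + 1); so w is isolating for f iff v
-- is isolating for g. Hence |Z(H,M+1,f)| = |Z₁(H,M+1,f)| + |Z(H,M,g)| ≥ Y₁(M+1,n) + |Z(H,M,g)|,
-- and induction on M gives |Z(H,M,f)| ≥ Σᵢ Y₁(i,n) for every admissible (H,f).
module Submission where

open import Defs
open import Data.Nat using (ℕ; zero; suc; _+_; _≤_; z≤n; s≤s)
open import Data.Nat.Properties
  using (+-suc; +-comm; +-identityʳ; +-mono-≤; ≤-refl; m≤n⇒m≤1+n; module ≤-Reasoning)
open import Data.Nat.ListAction using (sum)
open import Data.Nat.ListAction.Properties using (sum-++)
open import Data.Fin as Fin using (Fin)
open import Data.Fin.Properties using (any?)
open import Data.Vec as Vec using (Vec; []; _∷_; lookup)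
open import Data.Bool using (true; false)
open import Data.List using (List; []; _∷_; [_]; _++_; length; map; upTo; filter; mapMaybe)
open import Data.List.Properties using (upTo-∷ʳ; map-++)
open import Data.List.Membership.Propositional using (_∈_)
open import Data.List.Membership.Propositional.Properties using (∈-filter⁺; ∈-filter⁻)
open import Data.List.Relation.Unary.Any using (here; there)
import Data.List.Relation.Unary.All as All
open import Data.List.Relation.Unary.AllPairs using ([]; _∷_)
open import Data.List.Relation.Unary.Unique.Propositional using (Unique)
import Data.List.Relation.Unary.Unique.Propositional.Properties as Unique
open import Data.Maybe as Maybe using (Maybe; just; nothing)
open import Data.Maybe.Properties using (just-injective; map-nothing; map-just)
open import Data.Rational as ℚ using (ℚ)
open import Data.Product using (∃; ∃₂; _×_; _,_; proj₂)
open import Data.Sum using (inj₁; inj₂)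
open import Function using (_∘_)
open import Function.Bundles using (_⇔_; mk⇔; Equivalence)
open import Function.Construct.Composition using (_⇔-∘_)
open import Relation.Nullary using (¬_; yes; no; contradiction)
open import Relation.Unary using (Decidable)
open import Relation.Binary.PropositionalEquality
  using (_≡_; refl; sym; trans; cong; subst₂; module ≡-Reasoning)

open Equivalence using (to; from)

sumFrom1-suc : ∀ M g → sumFrom1 (suc M) g ≡ g (suc M) + sumFrom1 M g
sumFrom1-suc M g = begin
  sum (map (g ∘ suc) (upTo (suc M)))            ≡⟨ cong (sum ∘ map (g ∘ suc)) (upTo-∷ʳ M) ⟨
  sum (map (g ∘ suc) (upTo M ++ [ M ]))         ≡⟨ cong sum (map-++ (g ∘ suc) (upTo M) [ M ]) ⟩
  sum (map (g ∘ suc) (upTo M) ++ [ g (suc M) ]) ≡⟨ sum-++ (map (g ∘ suc) (upTo M)) _ ⟩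
  sumFrom1 M g + (g (suc M) + 0)                ≡⟨ cong (sumFrom1 M g +_) (+-identityʳ _) ⟩
  sumFrom1 M g + g (suc M)                      ≡⟨ +-comm (sumFrom1 M g) _ ⟩
  g (suc M) + sumFrom1 M g                      ∎
  where open ≡-Reasoning

module _ {A B : Set} {f : A → Maybe B} where

  ∈-mapMaybe⁺ : ∀ {x y xs} → x ∈ xs → f x ≡ just y → y ∈ mapMaybe f xs
  ∈-mapMaybe⁺ {xs = x ∷ _} (here refl) fx≡y with f x
  ... | just _ = here (just-injective (sym fx≡y))
  ∈-mapMaybe⁺ {xs = x ∷ _} (there x∈) fx≡y with f x
  ... | nothing = ∈-mapMaybe⁺ x∈ fx≡y
  ... | just _  = there (∈-mapMaybe⁺ x∈ fx≡y)

  ∈-mapMaybe⁻ : ∀ {y} xs → y ∈ mapMaybe f xs → ∃ λ x → x ∈ xs × f x ≡ just y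
  ∈-mapMaybe⁻ (x ∷ xs) y∈ with f x in fx≡
  ∈-mapMaybe⁻ (x ∷ xs) (here refl) | just _ = x , here refl , fx≡
  ∈-mapMaybe⁻ (x ∷ xs) (there y∈)  | just _ with x′ , x′∈ , fx′≡ ← ∈-mapMaybe⁻ xs y∈ =
    x′ , there x′∈ , fx′≡
  ∈-mapMaybe⁻ (x ∷ xs) y∈ | nothing with x′ , x′∈ , fx′≡ ← ∈-mapMaybe⁻ xs y∈ =
    x′ , there x′∈ , fx′≡

  mapMaybe-unique : (∀ {x x′ y} → f x ≡ just y → f x′ ≡ just y → x ≡ x′) →
                    ∀ {xs} → Unique xs → Unique (mapMaybe f xs)
  mapMaybe-unique f-inj [] = []
  mapMaybe-unique f-inj {x ∷ xs} (x∉xs ∷ uxs) with f x in fx≡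
  ... | nothing = mapMaybe-unique f-inj uxs
  ... | just y  = All.tabulate y∉ ∷ mapMaybe-unique f-inj uxs
    where
    y∉ : ∀ {y′} → y′ ∈ mapMaybe f xs → ¬ y ≡ y′
    y∉ y′∈ refl with x′ , x′∈ , fx′≡ ← ∈-mapMaybe⁻ xs y′∈ = All.lookup x∉xs x′∈ (f-inj fx≡ fx′≡)

  length-filter+mapMaybe : ∀ {P : A → Set} (P? : Decidable P) →
    (∀ x → P x → f x ≡ nothing) → (∀ x → f x ≡ nothing → P x) →
    ∀ xs → length xs ≡ length (filter P? xs) + length (mapMaybe f xs)
  length-filter+mapMaybe P? P⇒nothing nothing⇒P [] = refl
  length-filter+mapMaybe P? P⇒nothing nothing⇒P (x ∷ xs)
    with ih ← length-filter+mapMaybe P? P⇒nothing nothing⇒P xs | P? x | f x in fx≡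
  ... | yes _  | nothing = cong suc ih
  ... | yes px | just _  = contradiction (trans (sym fx≡) (P⇒nothing x px)) λ ()
  ... | no ¬px | nothing = contradiction (nothing⇒P x fx≡) ¬px
  ... | no _   | just _  = trans (cong suc ih) (sym (+-suc _ _))

fw-map : ∀ {K M n} (f : Fin M → ℚ) (g : Fin K → Fin M) (v : Vec (Fin K) n) e →
         fw f (Vec.map g v) e ≡ fw (f ∘ g) v e
fw-map f g []      []          = refl
fw-map f g (a ∷ v) (true ∷ e)  = cong (f (g a) ℚ.+_) (fw-map f g v e)
fw-map f g (a ∷ v) (false ∷ e) = fw-map f g v e

isMinimizer-resp-fw : ∀ {K M n} (H : Hypergraph n) {f : Fin M → ℚ} {f′ : Fin K → ℚ} {w w′} →
                      (∀ e → fw f w e ≡ fw f′ w′ e) →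
                      ∀ {e} → IsMinimizer H f w e → IsMinimizer H f′ w′ e
isMinimizer-resp-fw H fw≡ {e} (e∈ , min) = e∈ , λ e′∈ → subst₂ ℚ._≤_ (fw≡ e) (fw≡ _) (min e′∈)

isolating-resp-fw : ∀ {K M n} (H : Hypergraph n) {f : Fin M → ℚ} {f′ : Fin K → ℚ} {w w′} →
                    (∀ e → fw f w e ≡ fw f′ w′ e) → Isolating H f w → Isolating H f′ w′
isolating-resp-fw H fw≡ (inj₁ noEdges) = inj₁ noEdges
isolating-resp-fw H {f} {f′} {w} {w′} fw≡ (inj₂ (e , min , uniq)) =
  inj₂ (e , isMinimizer-resp-fw H {f} {f′} {w} {w′} fw≡ min ,
        λ e′ min′ → uniq e′ (isMinimizer-resp-fw H {f′} {f} {w′} {w} (sym ∘ fw≡) min′))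

isolating-map⇔ : ∀ {K M n} (H : Hypergraph n) (f : Fin M → ℚ) (g : Fin K → Fin M) v →
                 Isolating H f (Vec.map g v) ⇔ Isolating H (f ∘ g) v
isolating-map⇔ H f g v =
  mk⇔ (isolating-resp-fw H {f} {f ∘ g} {Vec.map g v} {v} (fw-map f g v))
      (isolating-resp-fw H {f ∘ g} {f} {v} {Vec.map g v} (sym ∘ fw-map f g v))

strictlyIncreasingPos-∘suc : ∀ {M} {f : Fin (suc M) → ℚ} →
                             StrictlyIncreasingPos f → StrictlyIncreasingPos (f ∘ Fin.suc)
strictlyIncreasingPos-∘suc (pos , mono) =
  pos ∘ Fin.suc , λ a b a<b → mono (Fin.suc a) (Fin.suc b) (s≤s a<b)

lower : ∀ {M n} → Vec (Fin (suc M)) n → Maybe (Vec (Fin M) n)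
lower []              = just []
lower (Fin.zero ∷ w)  = nothing
lower (Fin.suc a ∷ w) = Maybe.map (a ∷_) (lower w)

lower-map-suc : ∀ {M n} (v : Vec (Fin M) n) → lower (Vec.map Fin.suc v) ≡ just v
lower-map-suc []      = refl
lower-map-suc (a ∷ v) = map-just (lower-map-suc v)

lower≡just⇒map-suc : ∀ {M n} (w : Vec (Fin (suc M)) n) {v} →
                     lower w ≡ just v → w ≡ Vec.map Fin.suc v
lower≡just⇒map-suc []              refl = refl
lower≡just⇒map-suc (Fin.suc a ∷ w) eq with lower w in lw≡
... | just _ with refl ← eq = cong (Fin.suc a ∷_) (lower≡just⇒map-suc w lw≡)

hasMinOne⇒lower≡nothing : ∀ {M n} (w : Vec (Fin (suc M)) n) → HasMinOne w → lower w ≡ nothing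
hasMinOne⇒lower≡nothing (Fin.zero ∷ w)  _                     = refl
hasMinOne⇒lower≡nothing (Fin.suc a ∷ w) (Fin.suc x , wx≡zero) =
  map-nothing (hasMinOne⇒lower≡nothing w (x , wx≡zero))

lower≡nothing⇒hasMinOne : ∀ {M n} (w : Vec (Fin (suc M)) n) → lower w ≡ nothing → HasMinOne w
lower≡nothing⇒hasMinOne (Fin.zero ∷ w)  _  = Fin.zero , refl
lower≡nothing⇒hasMinOne (Fin.suc a ∷ w) eq with lower w in lw≡
... | nothing with x , wx≡zero ← lower≡nothing⇒hasMinOne w lw≡ = Fin.suc x , wx≡zero

hasMinOne? : ∀ {M n} → Decidable (HasMinOne {M} {n})
hasMinOne? w = any? (λ x → lookup w x Fin.≟ Fin.zero)

Enumerates : ∀ {M n} → (Vec (Fin M) n → Set) → List (Vec (Fin M) n) → Set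
Enumerates P L = Unique L × (∀ w → w ∈ L ⇔ P w)

enumerates-filter : ∀ {M n} {P Q : Vec (Fin M) n → Set} (Q? : Decidable Q) {L} →
                    Enumerates P L → Enumerates (λ w → P w × Q w) (filter Q? L)
enumerates-filter Q? (L-unique , L-mem) =
  Unique.filter⁺ Q? L-unique ,
  λ w → mk⇔ (λ w∈ → let w∈L , qw = ∈-filter⁻ Q? w∈ in to (L-mem w) w∈L , qw)
            (λ (pw , qw) → ∈-filter⁺ Q? (from (L-mem w) pw) qw)

enumerates-lower : ∀ {M n} {P : Vec (Fin (suc M)) n → Set} {L} →
                   Enumerates P L → Enumerates (P ∘ Vec.map Fin.suc) (mapMaybe lower L)
enumerates-lower {P = P} {L} (L-unique , L-mem) =
  mapMaybe-unique lower-injective L-unique , λ v → mk⇔ (lowered⇒P v) (P⇒lowered v)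
  where
  lower-injective : ∀ {w w′ v} → lower w ≡ just v → lower w′ ≡ just v → w ≡ w′
  lower-injective {w} {w′} lw≡ lw′≡ =
    trans (lower≡just⇒map-suc w lw≡) (sym (lower≡just⇒map-suc w′ lw′≡))

  lowered⇒P : ∀ v → v ∈ mapMaybe lower L → P (Vec.map Fin.suc v)
  lowered⇒P v v∈ with ∈-mapMaybe⁻ L v∈
  ... | w , w∈L , lw≡ with refl ← lower≡just⇒map-suc w lw≡ = to (L-mem w) w∈L

  P⇒lowered : ∀ v → P (Vec.map Fin.suc v) → v ∈ mapMaybe lower L
  P⇒lowered v pv = ∈-mapMaybe⁺ (from (L-mem _) pv) (lower-map-suc v)

hasCard-length : ∀ {M n} {P : Vec (Fin M) n → Set} {L} → Enumerates P L → HasCard P (length L)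
hasCard-length {L = L} (L-unique , L-mem) = L , L-unique , L-mem , refl

CardZ-split : ∀ {M n H} {f : Fin (suc M) → ℚ} {k} → CardZ (suc M) n H f k →
              ∃₂ λ k₁ k₀ → CardZ₁ M n H f k₁ × CardZ M n H (f ∘ Fin.suc) k₀ × k ≡ k₁ + k₀
CardZ-split {H = H} {f} (L , L-unique , L-mem , refl) =
  length Z₁ , length Z₀ ,
  hasCard-length (enumerates-filter hasMinOne? (L-unique , L-mem)) ,
  hasCard-length Z₀-enum ,
  length-filter+mapMaybe hasMinOne? hasMinOne⇒lower≡nothing lower≡nothing⇒hasMinOne L
  where
  Z₁ = filter hasMinOne? L
  Z₀ = mapMaybe lower L
  Z₀-enum : Enumerates (Isolating H (f ∘ Fin.suc)) Z₀
  Z₀-enum with Z₀-unique , Z₀-mem ← enumerates-lower {L = L} (L-unique , L-mem) =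
    Z₀-unique , λ v → isolating-map⇔ H f Fin.suc v ⇔-∘ Z₀-mem v

Y₁-LowerBound : ℕ → ℕ → ℕ → Set
Y₁-LowerBound M′ n y = ∀ H f k → StrictlyIncreasingPos f → CardZ₁ M′ n H f k → y ≤ k

sumFrom1-Y₁≤CardZ : ∀ M {n} (H : Hypergraph n) (f : Fin M → ℚ) {k} (y₁ : ℕ → ℕ) →
                    (∀ M′ → suc M′ ≤ M → Y₁-LowerBound M′ n (y₁ (suc M′))) →
                    StrictlyIncreasingPos f → CardZ M n H f k → sumFrom1 M y₁ ≤ k
sumFrom1-Y₁≤CardZ zero    H f y₁ y₁-bound f-sip card = z≤n
sumFrom1-Y₁≤CardZ (suc M) H f y₁ y₁-bound f-sip card
  with k₁ , k₀ , card₁ , card₀ , refl ← CardZ-split {H = H} card = begin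
    sumFrom1 (suc M) y₁        ≡⟨ sumFrom1-suc M y₁ ⟩
    y₁ (suc M) + sumFrom1 M y₁ ≤⟨ +-mono-≤ minOne shifted ⟩
    k₁ + k₀                    ∎
  where
  open ≤-Reasoning
  shifted : sumFrom1 M y₁ ≤ k₀
  shifted = sumFrom1-Y₁≤CardZ M H (f ∘ Fin.suc) y₁ (λ M′ → y₁-bound M′ ∘ m≤n⇒m≤1+n)
              (strictlyIncreasingPos-∘suc f-sip) card₀
  minOne : y₁ (suc M) ≤ k₁
  minOne = y₁-bound M ≤-refl H f k₁ f-sip card₁

-- The bound holds without the hypotheses 1 ≤ M and 1 ≤ n.
corollary1 : (M n : ℕ) → 1 ≤ M → 1 ≤ n →
    (y : ℕ) → IsY M n y →
    (y₁ : ℕ → ℕ) → (∀ M′ → suc M′ ≤ M → IsY₁ M′ n (y₁ (suc M′))) →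
    sumFrom1 M y₁ ≤ y
corollary1 M n _ _ y ((H , f , f-sip , card) , _) y₁ isY₁ =
  sumFrom1-Y₁≤CardZ M H f y₁ (λ M′ → proj₂ ∘ isY₁ M′) f-sip card
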